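{- The basic non-distributive modal logic $\mathbf{L}$ is complete with respect to the class of graph-based $\mathcal{L}$-frames: if an $\mathcal{L}$-sequent $\phi\vdash\psi$ satisfies $\mathbb{F}\models\phi\vdash\psi$ for every graph-based $\mathcal{L}$-frame $\mathbb{F}$, then $\phi\vdash\psi\in\mathbf{L}$.
   Context: $\mathcal{L}$-formulas: $\varphi::=\bot\mid\top\mid p\mid\varphi\wedge\varphi\mid\varphi\vee\varphi\mid\Box\varphi\mid\Diamond\varphi$, $p\in\mathsf{Prop}$. $\mathbf{L}$ is the smallest set of sequents containing $p\vdash p$, $\bot\vdash p$, $p\vdash\top$, $p\vdash p\vee q$, $q\vdash p\vee q$, $p\wedge q\vdash p$, $p\wedge q\vdash q$, $\top\vdash\Box\top$, $\Box p\wedge\Box q\vdash\Box(p\wedge q)$, $\Diamond\bot\vdash\bot$, $\Diamond p\vee\Diamond q\vdash\Diamond(p\vee q)$, closed under cut, uniform substitution, (from $\chi\vdash\phi,\chi\vdash\psi$ infer $\chi\vdash\phi\wedge\psi$), (from $\phi\vdash\chi,\psi\vdash\chi$ infer $\phi\vee\psi\vdash\chi$), and (from $\phi\vdash\psi$ infer $\Box\phi\vdash\Box\psi$ and $\Diamond\phi\vdash\Diamond\psi$). For $T\subseteq Z\times Z$: $T^{[1]}[B]=\{y\mid\forall b\in B\,((b,y)\notin T)\}$, $T^{[0]}[Y]=\{b\mid\forall y\in Y\,((b,y)\notin T)\}$. A graph-based $\mathcal{L}$-frame $\mathbb{F}=(Z,E,R_\Diamond,R_\Box)$: $Z$ nonempty,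 $E$ reflexive, and with $B^{[1]}:=E^{[1]}[B]$, $Y^{[0]}:=E^{[0]}[Y]$, $B^{[10]}:=(B^{[1]})^{[0]}$, $Y^{[01]}:=(Y^{[0]})^{[1]}$, for all $b,y$: $(R_\Box^{[0]}[y])^{[10]}\subseteq R_\Box^{[0]}[y]$, $(R_\Box^{[1]}[b])^{[01]}\subseteq R_\Box^{[1]}[b]$, $(R_\Diamond^{[0]}[b])^{[10]}\subseteq R_\Diamond^{[0]}[b]$, $(R_\Diamond^{[1]}[y])^{[01]}\subseteq R_\Diamond^{[1]}[y]$. A model assigns to each $p$ a pair $([\![p]\!],(\![p]\!))$ with $[\![p]\!]^{[1]}=(\![p]\!)$, $(\![p]\!)^{[0]}=[\![p]\!]$, extended by: $[\![\top]\!]=Z,(\![\top]\!)=\emptyset$; $[\![\bot]\!]=\emptyset,(\![\bot]\!)=Z$; $[\![\phi\wedge\psi]\!]=[\![\phi]\!]\cap[\![\psi]\!]$, $(\![\phi\wedge\psi]\!)=[\![\phi\wedge\psi]\!]^{[1]}$; $(\![\phi\vee\psi]\!)=(\![\phi]\!)\cap(\![\psi]\!)$, $[\![\phi\vee\psi]\!]=(\![\phi\vee\psi]\!)^{[0]}$; $[\![\Box\phi]\!]=R_\Box^{[0]}[(\![\phi]\!)]$, $(\![\Box\phi]\!)=[\![\Box\phi]\!]^{[1]}$; $(\![\Diamond\phi]\!)=R_\Diamond^{[0]}[[\![\phi]\!]]$, $[\![\Diamond\phi]\!]=(\![\Diamond\phi]\!)^{[0]}$. $\phi\vdash\psi$ is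 true in the model if $z\in[\![\phi]\!]$ and $z'\in(\![\psi]\!)$ imply $(z,z')\notin E$; $\mathbb{F}\models\phi\vdash\psi$ iff true in all models on $\mathbb{F}$. -}

module Defs where

open import Data.Nat using (ℕ)
open import Data.Product using (_×_; _,_; proj₁; proj₂)
open import Relation.Nullary using (¬_)
open import Relation.Binary.PropositionalEquality using (_≡_)

infixr 6 _∧'_
infixr 5 _∨'_

data Fm : Set where
  ⊥' ⊤'     : Fm
  var       : ℕ → Fm
  _∧'_ _∨'_ : Fm → Fm → Fm
  □ ◇       : Fm → Fm

sub : (ℕ → Fm) → Fm → Fm
sub σ ⊥'        = ⊥'
sub σ ⊤'        = ⊤'
sub σ (var n)   = σ n
sub σ (φ ∧' ψ)  = sub σ φ ∧' sub σ ψ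
sub σ (φ ∨' ψ)  = sub σ φ ∨' sub σ ψ
sub σ (□ φ)     = □ (sub σ φ)
sub σ (◇ φ)     = ◇ (sub σ φ)

p q : Fm
p = var 0
q = var 1

infix 4 _⊢L_

data _⊢L_ : Fm → Fm → Set where
  ax-id    : p ⊢L p
  ax-⊥     : ⊥' ⊢L p
  ax-⊤     : p ⊢L ⊤'
  ax-∨₁    : p ⊢L p ∨' q
  ax-∨₂    : q ⊢L p ∨' q
  ax-∧₁    : p ∧' q ⊢L p
  ax-∧₂    : p ∧' q ⊢L q
  ax-□⊤    : ⊤' ⊢L □ ⊤'
  ax-□∧    : □ p ∧' □ q ⊢L □ (p ∧' q)
  ax-◇⊥    : ◇ ⊥' ⊢L ⊥'
  ax-◇∨    : ◇ p ∨' ◇ q ⊢L ◇ (p ∨' q)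
  cut      : ∀ {φ χ ψ} → φ ⊢L χ → χ ⊢L ψ → φ ⊢L ψ
  subst    : ∀ {φ ψ} (σ : ℕ → Fm) → φ ⊢L ψ → sub σ φ ⊢L sub σ ψ
  ∧-intro  : ∀ {χ φ ψ} → χ ⊢L φ → χ ⊢L ψ → χ ⊢L φ ∧' ψ
  ∨-elim   : ∀ {φ ψ χ} → φ ⊢L χ → ψ ⊢L χ → φ ∨' ψ ⊢L χ
  □-mono   : ∀ {φ ψ} → φ ⊢L ψ → □ φ ⊢L □ ψ
  ◇-mono   : ∀ {φ ψ} → φ ⊢L ψ → ◇ φ ⊢L ◇ ψ

Sub : Set → Set₁
Sub Z = Z → Set

_⊆_ : {Z : Set} → Sub Z → Sub Z → Set
B ⊆ C = ∀ z → B z → C z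

_≐_ : {Z : Set} → Sub Z → Sub Z → Set
B ≐ C = (B ⊆ C) × (C ⊆ B)

｛_｝ : {Z : Set} → Z → Sub Z
｛ z ｝ = λ w → w ≡ z

_⁽¹⁾[_] : {Z : Set} → (Z → Z → Set) → Sub Z → Sub Z
(T ⁽¹⁾[ B ]) y = ∀ b → B b → ¬ T b y

_⁽⁰⁾[_] : {Z : Set} → (Z → Z → Set) → Sub Z → Sub Z
(T ⁽⁰⁾[ Y ]) b = ∀ y → Y y → ¬ T b y

record Frame : Set₁ where
  field
    Z    : Set
    E    : Z → Z → Set
    R◇   : Z → Z → Set
    R□   : Z → Z → Set
    inhabited : Z
    E-refl    : ∀ z → E z z

  _¹ : Sub Z → Sub Z
  B ¹ = E ⁽¹⁾[ B ]
  _⁰ : Sub Z → Sub Z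
  Y ⁰ = E ⁽⁰⁾[ Y ]
  _¹⁰ : Sub Z → Sub Z
  B ¹⁰ = (B ¹) ⁰
  _⁰¹ : Sub Z → Sub Z
  Y ⁰¹ = (Y ⁰) ¹

  field
    □-stable₀ : ∀ y → ((R□ ⁽⁰⁾[ ｛ y ｝ ]) ¹⁰) ⊆ (R□ ⁽⁰⁾[ ｛ y ｝ ])
    □-stable₁ : ∀ b → ((R□ ⁽¹⁾[ ｛ b ｝ ]) ⁰¹) ⊆ (R□ ⁽¹⁾[ ｛ b ｝ ])
    ◇-stable₀ : ∀ b → ((R◇ ⁽⁰⁾[ ｛ b ｝ ]) ¹⁰) ⊆ (R◇ ⁽⁰⁾[ ｛ b ｝ ])
    ◇-stable₁ : ∀ y → ((R◇ ⁽¹⁾[ ｛ y ｝ ]) ⁰¹) ⊆ (R◇ ⁽¹⁾[ ｛ y ｝ ])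

module _ (F : Frame) where
  open Frame F

  record Valuation : Set₁ where
    field
      ext  : ℕ → Sub Z
      ant  : ℕ → Sub Z
      ext¹ : ∀ n → (ext n ¹) ≐ ant n
      ant⁰ : ∀ n → (ant n ⁰) ≐ ext n

  module _ (V : Valuation) where
    open Valuation V

    ⟦_⟧ : Fm → Sub Z
    ⦅_⦆ : Fm → Sub Z
    ⟦ ⊥' ⟧     = λ _ → ⊥ where open import Data.Empty using (⊥)
    ⟦ ⊤' ⟧     = λ _ → ⊤ where open import Data.Unit using (⊤)
    ⟦ var n ⟧  = ext n
    ⟦ φ ∧' ψ ⟧ = λ z → ⟦ φ ⟧ z × ⟦ ψ ⟧ z
    ⟦ φ ∨' ψ ⟧ = (λ z → ⦅ φ ⦆ z × ⦅ ψ ⦆ z) ⁰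
    ⟦ □ φ ⟧    = R□ ⁽⁰⁾[ ⦅ φ ⦆ ]
    ⟦ ◇ φ ⟧    = (R◇ ⁽⁰⁾[ ⟦ φ ⟧ ]) ⁰
    ⦅ ⊥' ⦆     = λ _ → ⊤ where open import Data.Unit using (⊤)
    ⦅ ⊤' ⦆     = λ _ → ⊥ where open import Data.Empty using (⊥)
    ⦅ var n ⦆  = ant n
    ⦅ φ ∧' ψ ⦆ = (λ z → ⟦ φ ⟧ z × ⟦ ψ ⟧ z) ¹
    ⦅ φ ∨' ψ ⦆ = λ z → ⦅ φ ⦆ z × ⦅ ψ ⦆ z
    ⦅ □ φ ⦆    = (R□ ⁽⁰⁾[ ⦅ φ ⦆ ]) ¹
    ⦅ ◇ φ ⦆    = R◇ ⁽⁰⁾[ ⟦ φ ⟧ ]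

    TrueIn : Fm → Fm → Set
    TrueIn φ ψ = ∀ z z' → ⟦ φ ⟧ z → ⦅ ψ ⦆ z' → ¬ E z z'

  _⊨_⊢_ : Fm → Fm → Set₁
  _⊨_⊢_ φ ψ = (V : Valuation) → TrueIn V φ ψ

-- Constructively, the canonical-model argument needs L to be decidable: the
-- polarity operators only ever produce double negations of derivations.
-- Decidability, and the adjunction a ⊢ □ c ⇔ □-content a ⊢ c, come from a
-- cut-free sequent calculus equivalent to L.
--
-- A canonical point is a pair of formulas (fil, idl) with fil ⊬ idl, read as
-- a filter and an ideal, together with finitely many formulas whose diamonds
-- lie below idl.  By the truth lemma a formula holds at the points whose fil
-- entails it, and is refuted at least by the points whose idl it entails and
-- whose ◇-data cover finitely many witnesses.  If φ ⊬ ψ, the point (φ, ψ)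
-- satisfies φ and is E-related to the point (⊤, ψ, witnesses of ψ), which
-- refutes ψ; so φ ⊢ ψ fails on the canonical frame.
module Submission where

open import Defs
open import Data.Bool using (Bool; true; false; T; _∧_; _∨_)
open import Data.Bool.Properties using (T-∧; T-∨)
open import Data.Empty using (⊥; ⊥-elim)
open import Data.List using (List; []; _∷_; _++_; map)
open import Data.List.Relation.Unary.All as All using (All; []; _∷_)
open import Data.List.Relation.Unary.All.Properties using (++⁺; ++⁻ˡ; ++⁻ʳ)
open import Data.List.Relation.Unary.Any as Any using (Any; here; there; any?)
open import Data.Nat using (ℕ; zero; suc; _+_; _≤_; _≟_)
open import Data.Nat.ListAction using (sum)
open import Data.Nat.Properties using (m+n≤o⇒m≤o; m+n≤o⇒n≤o; 1+n≰n; ≤-refl)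
open import Data.Product using (_×_; _,_; proj₁; proj₂)
open import Data.Sum using (_⊎_; inj₁; inj₂; [_,_]′)
open import Data.Unit using (⊤; tt)
open import Function using (_∘_; _⇔_; mk⇔; Equivalence)
open import Relation.Nullary using (¬_; Dec; yes; no)
open import Relation.Nullary.Decidable using (map′; _⊎-dec_; _×-dec_; decidable-stable; T?)
open import Relation.Binary.PropositionalEquality using (_≡_; refl)

open Equivalence using (to; from)

pq↦ : Fm → Fm → ℕ → Fm
pq↦ φ ψ zero    = φ
pq↦ φ ψ (suc _) = ψ

⊢L-refl : ∀ {φ} → φ ⊢L φ
⊢L-refl {φ} = subst (pq↦ φ φ) ax-id

⊥⊢L : ∀ {φ} → ⊥' ⊢L φ
⊥⊢L {φ} = subst (pq↦ φ φ) ax-⊥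

⊢L⊤ : ∀ {φ} → φ ⊢L ⊤'
⊢L⊤ {φ} = subst (pq↦ φ φ) ax-⊤

∨-inj₁ : ∀ {φ ψ} → φ ⊢L φ ∨' ψ
∨-inj₁ {φ} {ψ} = subst (pq↦ φ ψ) ax-∨₁

∨-inj₂ : ∀ {φ ψ} → ψ ⊢L φ ∨' ψ
∨-inj₂ {φ} {ψ} = subst (pq↦ φ ψ) ax-∨₂

∧-proj₁ : ∀ {φ ψ} → φ ∧' ψ ⊢L φ
∧-proj₁ {φ} {ψ} = subst (pq↦ φ ψ) ax-∧₁

∧-proj₂ : ∀ {φ ψ} → φ ∧' ψ ⊢L ψ
∧-proj₂ {φ} {ψ} = subst (pq↦ φ ψ) ax-∧₂

□-∧ : ∀ {φ ψ} → □ φ ∧' □ ψ ⊢L □ (φ ∧' ψ)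
□-∧ {φ} {ψ} = subst (pq↦ φ ψ) ax-□∧

⊢L□⊤ : ∀ {φ} → φ ⊢L □ ⊤'
⊢L□⊤ = cut ⊢L⊤ ax-□⊤

◇-refutable : ∀ {φ χ} → φ ⊢L ⊥' → ◇ φ ⊢L χ
◇-refutable φ⊢⊥ = cut (◇-mono φ⊢⊥) (cut ax-◇⊥ ⊥⊢L)

refutable : Fm → Bool
refutable ⊥'       = true
refutable ⊤'       = false
refutable (var _)  = false
refutable (a ∧' b) = refutable a ∨ refutable b
refutable (a ∨' b) = refutable a ∧ refutable b
refutable (□ _)    = false
refutable (◇ a)    = refutable a

⊥-if : Bool → Fm
⊥-if true  = ⊥'
⊥-if false = ⊤'

-- The weakest c with a ⊢ □ c.  It lets the □-rule of the cut-free calculus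
-- below accept an arbitrary antecedent, which is what makes cut admissible.
□-content : Fm → Fm
□-content ⊥'       = ⊥'
□-content ⊤'       = ⊤'
□-content (var _)  = ⊤'
□-content (a ∧' b) = □-content a ∧' □-content b
□-content (a ∨' b) = □-content a ∨' □-content b
□-content (□ a)    = a
□-content (◇ a)    = ⊥-if (refutable a)

infix 4 _⊢ᶜ_

data _⊢ᶜ_ : Fm → Fm → Set where
  ⊤R  : ∀ {a} → a ⊢ᶜ ⊤'
  ⊥L  : ∀ {c} → ⊥' ⊢ᶜ c
  ax  : ∀ {n} → var n ⊢ᶜ var n
  ∧R  : ∀ {a b c} → a ⊢ᶜ b → a ⊢ᶜ c → a ⊢ᶜ b ∧' c
  ∧L₁ : ∀ {a b c} → a ⊢ᶜ c → a ∧' b ⊢ᶜ c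
  ∧L₂ : ∀ {a b c} → b ⊢ᶜ c → a ∧' b ⊢ᶜ c
  ∨R₁ : ∀ {a b c} → a ⊢ᶜ b → a ⊢ᶜ b ∨' c
  ∨R₂ : ∀ {a b c} → a ⊢ᶜ c → a ⊢ᶜ b ∨' c
  ∨L  : ∀ {a b c} → a ⊢ᶜ c → b ⊢ᶜ c → a ∨' b ⊢ᶜ c
  □R  : ∀ {a c} → □-content a ⊢ᶜ c → a ⊢ᶜ □ c
  ◇◇  : ∀ {a b} → a ⊢ᶜ b → ◇ a ⊢ᶜ ◇ b
  ◇L  : ∀ {a c} → a ⊢ᶜ ⊥' → ◇ a ⊢ᶜ c

⊢ᶜ-refl : ∀ a → a ⊢ᶜ a
⊢ᶜ-refl ⊥'       = ⊥L
⊢ᶜ-refl ⊤'       = ⊤R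
⊢ᶜ-refl (var _)  = ax
⊢ᶜ-refl (a ∧' b) = ∧R (∧L₁ (⊢ᶜ-refl a)) (∧L₂ (⊢ᶜ-refl b))
⊢ᶜ-refl (a ∨' b) = ∨L (∨R₁ (⊢ᶜ-refl a)) (∨R₂ (⊢ᶜ-refl b))
⊢ᶜ-refl (□ a)    = □R (⊢ᶜ-refl a)
⊢ᶜ-refl (◇ a)    = ◇◇ (⊢ᶜ-refl a)

refutable⇒⊢ᶜ⊥ : ∀ a → T (refutable a) → a ⊢ᶜ ⊥'
refutable⇒⊢ᶜ⊥ ⊥'       _ = ⊥L
refutable⇒⊢ᶜ⊥ (a ∧' b) r =
  [ ∧L₁ ∘ refutable⇒⊢ᶜ⊥ a , ∧L₂ ∘ refutable⇒⊢ᶜ⊥ b ]′ (to T-∨ r)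
refutable⇒⊢ᶜ⊥ (a ∨' b) r =
  ∨L (refutable⇒⊢ᶜ⊥ a (proj₁ (to T-∧ r))) (refutable⇒⊢ᶜ⊥ b (proj₂ (to T-∧ r)))
refutable⇒⊢ᶜ⊥ (◇ a)    r = ◇L (refutable⇒⊢ᶜ⊥ a r)

refutable-antitone : ∀ {a b} → a ⊢ᶜ b → T (refutable b) → T (refutable a)
refutable-antitone ⊥L                _ = tt
refutable-antitone ax                r = r
refutable-antitone (∧R {b = b} d e)  r =
  [ refutable-antitone d , refutable-antitone e ]′ (to (T-∨ {refutable b}) r)
refutable-antitone (∧L₁ d)           r = from T-∨ (inj₁ (refutable-antitone d r))
refutable-antitone (∧L₂ {a = a} d)   r = from (T-∨ {refutable a}) (inj₂ (refutable-antitone d r))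
refutable-antitone (∨R₁ d)           r = refutable-antitone d (proj₁ (to T-∧ r))
refutable-antitone (∨R₂ {b = b} d)   r = refutable-antitone d (proj₂ (to (T-∧ {refutable b}) r))
refutable-antitone (∨L d e)          r = from T-∧ (refutable-antitone d r , refutable-antitone e r)
refutable-antitone (◇◇ d)            r = refutable-antitone d r
refutable-antitone (◇L d)            _ = refutable-antitone d tt

⊥-if-true : ∀ {x c} → T x → ⊥-if x ⊢ᶜ c
⊥-if-true {true} _ = ⊥L

⊥-if-antitone : ∀ x y → (T y → T x) → ⊥-if x ⊢ᶜ ⊥-if y
⊥-if-antitone true  _     _ = ⊥L
⊥-if-antitone false false _ = ⊤R
⊥-if-antitone false true  f = ⊥-elim (f tt)

□-content-mono : ∀ {a b} → a ⊢ᶜ b → □-content a ⊢ᶜ □-content b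
□-content-mono ⊤R        = ⊤R
□-content-mono ⊥L        = ⊥L
□-content-mono ax        = ⊤R
□-content-mono (∧R d e)  = ∧R (□-content-mono d) (□-content-mono e)
□-content-mono (∧L₁ d)   = ∧L₁ (□-content-mono d)
□-content-mono (∧L₂ d)   = ∧L₂ (□-content-mono d)
□-content-mono (∨R₁ d)   = ∨R₁ (□-content-mono d)
□-content-mono (∨R₂ d)   = ∨R₂ (□-content-mono d)
□-content-mono (∨L d e)  = ∨L (□-content-mono d) (□-content-mono e)
□-content-mono (□R d)    = d
□-content-mono (◇◇ {a} {b} d) =
  ⊥-if-antitone (refutable a) (refutable b) (refutable-antitone d)
□-content-mono (◇L d)    = ⊥-if-true (refutable-antitone d tt)

-- Terminates by lexicographic descent on the right derivation, then the left
-- one: only the □R case replaces the left derivation, by □-content-mono d.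
⊢ᶜ-trans : ∀ {a b c} → a ⊢ᶜ b → b ⊢ᶜ c → a ⊢ᶜ c
⊢ᶜ-trans ⊥L        _         = ⊥L
⊢ᶜ-trans (∧L₁ d)   e         = ∧L₁ (⊢ᶜ-trans d e)
⊢ᶜ-trans (∧L₂ d)   e         = ∧L₂ (⊢ᶜ-trans d e)
⊢ᶜ-trans (∨L d d') e         = ∨L (⊢ᶜ-trans d e) (⊢ᶜ-trans d' e)
⊢ᶜ-trans (◇L d)    _         = ◇L d
⊢ᶜ-trans _         ⊤R        = ⊤R
⊢ᶜ-trans d         (∧R e e') = ∧R (⊢ᶜ-trans d e) (⊢ᶜ-trans d e')
⊢ᶜ-trans d         (∨R₁ e)   = ∨R₁ (⊢ᶜ-trans d e)
⊢ᶜ-trans d         (∨R₂ e)   = ∨R₂ (⊢ᶜ-trans d e)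
⊢ᶜ-trans d         (□R e)    = □R (⊢ᶜ-trans (□-content-mono d) e)
⊢ᶜ-trans ax        e         = e
⊢ᶜ-trans (∧R d _)  (∧L₁ e)   = ⊢ᶜ-trans d e
⊢ᶜ-trans (∧R _ d)  (∧L₂ e)   = ⊢ᶜ-trans d e
⊢ᶜ-trans (∨R₁ d)   (∨L e _)  = ⊢ᶜ-trans d e
⊢ᶜ-trans (∨R₂ d)   (∨L _ e)  = ⊢ᶜ-trans d e
⊢ᶜ-trans (◇◇ d)    (◇◇ e)    = ◇◇ (⊢ᶜ-trans d e)
⊢ᶜ-trans (◇◇ d)    (◇L e)    = ◇L (⊢ᶜ-trans d e)

refutable-sub : ∀ σ a → T (refutable a) → T (refutable (sub σ a))
refutable-sub σ ⊥'       _ = tt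
refutable-sub σ (a ∧' b) r =
  from T-∨ ([ inj₁ ∘ refutable-sub σ a , inj₂ ∘ refutable-sub σ b ]′ (to T-∨ r))
refutable-sub σ (a ∨' b) r =
  from T-∧ (refutable-sub σ a (proj₁ (to T-∧ r)) , refutable-sub σ b (proj₂ (to T-∧ r)))
refutable-sub σ (◇ a)    r = refutable-sub σ a r

□-content-sub : ∀ σ a → □-content (sub σ a) ⊢ᶜ sub σ (□-content a)
□-content-sub σ ⊥'       = ⊥L
□-content-sub σ ⊤'       = ⊤R
□-content-sub σ (var _)  = ⊤R
□-content-sub σ (a ∧' b) = ∧R (∧L₁ (□-content-sub σ a)) (∧L₂ (□-content-sub σ b))
□-content-sub σ (a ∨' b) = ∨L (∨R₁ (□-content-sub σ a)) (∨R₂ (□-content-sub σ b))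
□-content-sub σ (□ a)    = ⊢ᶜ-refl (sub σ a)
□-content-sub σ (◇ a) with refutable a | refutable-sub σ a
... | true  | r = ⊥-if-true (r tt)
... | false | _ = ⊤R

⊢ᶜ-sub : ∀ σ {a b} → a ⊢ᶜ b → sub σ a ⊢ᶜ sub σ b
⊢ᶜ-sub σ ⊤R           = ⊤R
⊢ᶜ-sub σ ⊥L           = ⊥L
⊢ᶜ-sub σ (ax {n})     = ⊢ᶜ-refl (σ n)
⊢ᶜ-sub σ (∧R d e)     = ∧R (⊢ᶜ-sub σ d) (⊢ᶜ-sub σ e)
⊢ᶜ-sub σ (∧L₁ d)      = ∧L₁ (⊢ᶜ-sub σ d)
⊢ᶜ-sub σ (∧L₂ d)      = ∧L₂ (⊢ᶜ-sub σ d)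
⊢ᶜ-sub σ (∨R₁ d)      = ∨R₁ (⊢ᶜ-sub σ d)
⊢ᶜ-sub σ (∨R₂ d)      = ∨R₂ (⊢ᶜ-sub σ d)
⊢ᶜ-sub σ (∨L d e)     = ∨L (⊢ᶜ-sub σ d) (⊢ᶜ-sub σ e)
⊢ᶜ-sub σ (□R {a} d)   = □R (⊢ᶜ-trans (□-content-sub σ a) (⊢ᶜ-sub σ d))
⊢ᶜ-sub σ (◇◇ d)       = ◇◇ (⊢ᶜ-sub σ d)
⊢ᶜ-sub σ (◇L d)       = ◇L (⊢ᶜ-sub σ d)

⊢L⇒⊢ᶜ : ∀ {a b} → a ⊢L b → a ⊢ᶜ b
⊢L⇒⊢ᶜ ax-id           = ax
⊢L⇒⊢ᶜ ax-⊥            = ⊥L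
⊢L⇒⊢ᶜ ax-⊤            = ⊤R
⊢L⇒⊢ᶜ ax-∨₁           = ∨R₁ ax
⊢L⇒⊢ᶜ ax-∨₂           = ∨R₂ ax
⊢L⇒⊢ᶜ ax-∧₁           = ∧L₁ ax
⊢L⇒⊢ᶜ ax-∧₂           = ∧L₂ ax
⊢L⇒⊢ᶜ ax-□⊤           = □R ⊤R
⊢L⇒⊢ᶜ ax-□∧           = □R (⊢ᶜ-refl (p ∧' q))
⊢L⇒⊢ᶜ ax-◇⊥           = ◇L ⊥L
⊢L⇒⊢ᶜ ax-◇∨           = ∨L (◇◇ (∨R₁ ax)) (◇◇ (∨R₂ ax))
⊢L⇒⊢ᶜ (cut d e)       = ⊢ᶜ-trans (⊢L⇒⊢ᶜ d) (⊢L⇒⊢ᶜ e)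
⊢L⇒⊢ᶜ (subst σ d)     = ⊢ᶜ-sub σ (⊢L⇒⊢ᶜ d)
⊢L⇒⊢ᶜ (∧-intro d e)   = ∧R (⊢L⇒⊢ᶜ d) (⊢L⇒⊢ᶜ e)
⊢L⇒⊢ᶜ (∨-elim d e)    = ∨L (⊢L⇒⊢ᶜ d) (⊢L⇒⊢ᶜ e)
⊢L⇒⊢ᶜ (□-mono d)      = □R (⊢L⇒⊢ᶜ d)
⊢L⇒⊢ᶜ (◇-mono d)      = ◇◇ (⊢L⇒⊢ᶜ d)

refutable⇒⊢L⊥ : ∀ a → T (refutable a) → a ⊢L ⊥'
refutable⇒⊢L⊥ ⊥'       _ = ⊥⊢L
refutable⇒⊢L⊥ (a ∧' b) r =
  [ cut ∧-proj₁ ∘ refutable⇒⊢L⊥ a , cut ∧-proj₂ ∘ refutable⇒⊢L⊥ b ]′ (to T-∨ r)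
refutable⇒⊢L⊥ (a ∨' b) r =
  ∨-elim (refutable⇒⊢L⊥ a (proj₁ (to T-∧ r))) (refutable⇒⊢L⊥ b (proj₂ (to T-∧ r)))
refutable⇒⊢L⊥ (◇ a)    r = ◇-refutable (refutable⇒⊢L⊥ a r)

⊢L□□-content : ∀ a → a ⊢L □ (□-content a)
⊢L□□-content ⊥'       = ⊥⊢L
⊢L□□-content ⊤'       = ax-□⊤
⊢L□□-content (var _)  = ⊢L□⊤
⊢L□□-content (a ∧' b) =
  cut (∧-intro (cut ∧-proj₁ (⊢L□□-content a)) (cut ∧-proj₂ (⊢L□□-content b))) □-∧
⊢L□□-content (a ∨' b) =
  ∨-elim (cut (⊢L□□-content a) (□-mono ∨-inj₁)) (cut (⊢L□□-content b) (□-mono ∨-inj₂))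
⊢L□□-content (□ a)    = ⊢L-refl
⊢L□□-content (◇ a) with refutable a | refutable⇒⊢L⊥ a
... | true  | r = ◇-refutable (r tt)
... | false | _ = ⊢L□⊤

⊢ᶜ⇒⊢L : ∀ {a b} → a ⊢ᶜ b → a ⊢L b
⊢ᶜ⇒⊢L ⊤R           = ⊢L⊤
⊢ᶜ⇒⊢L ⊥L           = ⊥⊢L
⊢ᶜ⇒⊢L ax           = ⊢L-refl
⊢ᶜ⇒⊢L (∧R d e)     = ∧-intro (⊢ᶜ⇒⊢L d) (⊢ᶜ⇒⊢L e)
⊢ᶜ⇒⊢L (∧L₁ d)      = cut ∧-proj₁ (⊢ᶜ⇒⊢L d)
⊢ᶜ⇒⊢L (∧L₂ d)      = cut ∧-proj₂ (⊢ᶜ⇒⊢L d)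
⊢ᶜ⇒⊢L (∨R₁ d)      = cut (⊢ᶜ⇒⊢L d) ∨-inj₁
⊢ᶜ⇒⊢L (∨R₂ d)      = cut (⊢ᶜ⇒⊢L d) ∨-inj₂
⊢ᶜ⇒⊢L (∨L d e)     = ∨-elim (⊢ᶜ⇒⊢L d) (⊢ᶜ⇒⊢L e)
⊢ᶜ⇒⊢L (□R {a} d)   = cut (⊢L□□-content a) (□-mono (⊢ᶜ⇒⊢L d))
⊢ᶜ⇒⊢L (◇◇ d)       = ◇-mono (⊢ᶜ⇒⊢L d)
⊢ᶜ⇒⊢L (◇L d)       = ◇-refutable (⊢ᶜ⇒⊢L d)

□-content-adjoint : ∀ {a c} → (a ⊢L □ c) ⇔ (□-content a ⊢L c)
□-content-adjoint {a} = mk⇔ (⊢ᶜ⇒⊢L ∘ □-content-mono ∘ ⊢L⇒⊢ᶜ)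
                            (λ d → cut (⊢L□□-content a) (□-mono d))

-- Inversion of the last rule of a derivation; ◇◇ is filed among the left
-- rules and ax among the right ones.
IsVar : ℕ → Fm → Set
IsVar n (var m) = m ≡ n
IsVar n _       = ⊥

◇◇-Premise : Fm → Fm → Set
◇◇-Premise a (◇ b) = a ⊢ᶜ b
◇◇-Premise _ _     = ⊥

LeftPremises : Fm → Fm → Set
LeftPremises ⊥'       c = ⊤
LeftPremises (a ∧' b) c = a ⊢ᶜ c ⊎ b ⊢ᶜ c
LeftPremises (a ∨' b) c = a ⊢ᶜ c × b ⊢ᶜ c
LeftPremises (◇ a)    c = a ⊢ᶜ ⊥' ⊎ ◇◇-Premise a c
LeftPremises _        _ = ⊥

RightPremises : Fm → Fm → Set
RightPremises a ⊤'       = ⊤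
RightPremises a (var n)  = IsVar n a
RightPremises a (b ∧' c) = a ⊢ᶜ b × a ⊢ᶜ c
RightPremises a (b ∨' c) = a ⊢ᶜ b ⊎ a ⊢ᶜ c
RightPremises a (□ c)    = □-content a ⊢ᶜ c
RightPremises _ _        = ⊥

⊢ᶜ⇒Premises : ∀ {a b} → a ⊢ᶜ b → LeftPremises a b ⊎ RightPremises a b
⊢ᶜ⇒Premises ⊤R        = inj₂ tt
⊢ᶜ⇒Premises ⊥L        = inj₁ tt
⊢ᶜ⇒Premises ax        = inj₂ refl
⊢ᶜ⇒Premises (∧R d e)  = inj₂ (d , e)
⊢ᶜ⇒Premises (∧L₁ d)   = inj₁ (inj₁ d)
⊢ᶜ⇒Premises (∧L₂ d)   = inj₁ (inj₂ d)
⊢ᶜ⇒Premises (∨R₁ d)   = inj₂ (inj₁ d)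
⊢ᶜ⇒Premises (∨R₂ d)   = inj₂ (inj₂ d)
⊢ᶜ⇒Premises (∨L d e)  = inj₁ (d , e)
⊢ᶜ⇒Premises (□R d)    = inj₂ d
⊢ᶜ⇒Premises (◇◇ d)    = inj₁ (inj₂ d)
⊢ᶜ⇒Premises (◇L d)    = inj₁ (inj₁ d)

◇◇-Premise⇒⊢ᶜ : ∀ a c → ◇◇-Premise a c → ◇ a ⊢ᶜ c
◇◇-Premise⇒⊢ᶜ a (◇ b) d = ◇◇ d

IsVar⇒⊢ᶜ : ∀ {n} a → IsVar n a → a ⊢ᶜ var n
IsVar⇒⊢ᶜ (var m) refl = ax

LeftPremises⇒⊢ᶜ : ∀ a c → LeftPremises a c → a ⊢ᶜ c
LeftPremises⇒⊢ᶜ ⊥'       c _              = ⊥L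
LeftPremises⇒⊢ᶜ (a ∧' b) c (inj₁ d)       = ∧L₁ d
LeftPremises⇒⊢ᶜ (a ∧' b) c (inj₂ d)       = ∧L₂ d
LeftPremises⇒⊢ᶜ (a ∨' b) c (d , e)        = ∨L d e
LeftPremises⇒⊢ᶜ (◇ a)    c (inj₁ d)       = ◇L d
LeftPremises⇒⊢ᶜ (◇ a)    c (inj₂ d)       = ◇◇-Premise⇒⊢ᶜ a c d

RightPremises⇒⊢ᶜ : ∀ a c → RightPremises a c → a ⊢ᶜ c
RightPremises⇒⊢ᶜ a ⊤'       _        = ⊤R
RightPremises⇒⊢ᶜ a (var n)  v        = IsVar⇒⊢ᶜ a v
RightPremises⇒⊢ᶜ a (b ∧' c) (d , e)  = ∧R d e
RightPremises⇒⊢ᶜ a (b ∨' c) (inj₁ d) = ∨R₁ d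
RightPremises⇒⊢ᶜ a (b ∨' c) (inj₂ d) = ∨R₂ d
RightPremises⇒⊢ᶜ a (□ c)    d        = □R d

_⊢ᶜ⊥? : ∀ a → Dec (a ⊢ᶜ ⊥')
a ⊢ᶜ⊥? = map′ (refutable⇒⊢ᶜ⊥ a) (λ d → refutable-antitone d tt) (T? (refutable a))

IsVar? : ∀ n a → Dec (IsVar n a)
IsVar? n ⊥'       = no λ ()
IsVar? n ⊤'       = no λ ()
IsVar? n (var m)  = m ≟ n
IsVar? n (_ ∧' _) = no λ ()
IsVar? n (_ ∨' _) = no λ ()
IsVar? n (□ _)    = no λ ()
IsVar? n (◇ _)    = no λ ()

-- Terminates by lexicographic descent on the succedent, then the antecedent.
_⊢ᶜ?_ : ∀ a b → Dec (a ⊢ᶜ b)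
LeftPremises? : ∀ a c → Dec (LeftPremises a c)
RightPremises? : ∀ a c → Dec (RightPremises a c)
◇◇-Premise? : ∀ a c → Dec (◇◇-Premise a c)

a ⊢ᶜ? b = map′ [ LeftPremises⇒⊢ᶜ a b , RightPremises⇒⊢ᶜ a b ]′ ⊢ᶜ⇒Premises
               (LeftPremises? a b ⊎-dec RightPremises? a b)

LeftPremises? ⊥'       c = yes tt
LeftPremises? ⊤'       c = no λ ()
LeftPremises? (var _)  c = no λ ()
LeftPremises? (a ∧' b) c = (a ⊢ᶜ? c) ⊎-dec (b ⊢ᶜ? c)
LeftPremises? (a ∨' b) c = (a ⊢ᶜ? c) ×-dec (b ⊢ᶜ? c)
LeftPremises? (□ _)    c = no λ ()
LeftPremises? (◇ a)    c = (a ⊢ᶜ⊥?) ⊎-dec ◇◇-Premise? a c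

RightPremises? a ⊥'       = no λ ()
RightPremises? a ⊤'       = yes tt
RightPremises? a (var n)  = IsVar? n a
RightPremises? a (b ∧' c) = (a ⊢ᶜ? b) ×-dec (a ⊢ᶜ? c)
RightPremises? a (b ∨' c) = (a ⊢ᶜ? b) ⊎-dec (a ⊢ᶜ? c)
RightPremises? a (□ c)    = □-content a ⊢ᶜ? c
RightPremises? a (◇ _)    = no λ ()

◇◇-Premise? a ⊥'       = no λ ()
◇◇-Premise? a ⊤'       = no λ ()
◇◇-Premise? a (var _)  = no λ ()
◇◇-Premise? a (_ ∧' _) = no λ ()
◇◇-Premise? a (_ ∨' _) = no λ ()
◇◇-Premise? a (□ _)    = no λ ()
◇◇-Premise? a (◇ b)    = a ⊢ᶜ? b

_⊢L?_ : ∀ a b → Dec (a ⊢L b)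
a ⊢L? b = map′ ⊢ᶜ⇒⊢L ⊢L⇒⊢ᶜ (a ⊢ᶜ? b)

⊤⊬⊥ : ¬ (⊤' ⊢L ⊥')
⊤⊬⊥ d with ⊢L⇒⊢ᶜ d
... | ()

var⊬⊥ : ∀ {n} → ¬ (var n ⊢L ⊥')
var⊬⊥ d with ⊢L⇒⊢ᶜ d
... | ()

⊤⊬var : ∀ {n} → ¬ (⊤' ⊢L var n)
⊤⊬var d with ⊢L⇒⊢ᶜ d
... | ()

varBound : Fm → ℕ
varBound ⊥'       = 0
varBound ⊤'       = 0
varBound (var n)  = suc n
varBound (a ∧' b) = varBound a + varBound b
varBound (a ∨' b) = varBound a + varBound b
varBound (□ a)    = varBound a
varBound (◇ a)    = varBound a

fresh-var-⊢ᶜ : ∀ {m a} → varBound a ≤ m → var m ⊢ᶜ a → ⊤' ⊢ᶜ a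
fresh-var-⊢ᶜ _  ⊤R                 = ⊤R
fresh-var-⊢ᶜ le ax                 = ⊥-elim (1+n≰n le)
fresh-var-⊢ᶜ le (∧R {b = b} d e)   =
  ∧R (fresh-var-⊢ᶜ (m+n≤o⇒m≤o (varBound b) le) d) (fresh-var-⊢ᶜ (m+n≤o⇒n≤o (varBound b) le) e)
fresh-var-⊢ᶜ le (∨R₁ {b = b} d)    = ∨R₁ (fresh-var-⊢ᶜ (m+n≤o⇒m≤o (varBound b) le) d)
fresh-var-⊢ᶜ le (∨R₂ {b = b} d)    = ∨R₂ (fresh-var-⊢ᶜ (m+n≤o⇒n≤o (varBound b) le) d)
fresh-var-⊢ᶜ _  (□R d)             = □R d

fresh-var-Any : ∀ {m} Φ → sum (map varBound Φ) ≤ m → Any (var m ⊢L_) Φ → Any (⊤' ⊢L_) Φ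
fresh-var-Any (φ ∷ Φ) le (here d)  =
  here (⊢ᶜ⇒⊢L (fresh-var-⊢ᶜ (m+n≤o⇒m≤o (varBound φ) le) (⊢L⇒⊢ᶜ d)))
fresh-var-Any (φ ∷ Φ) le (there a) = there (fresh-var-Any Φ (m+n≤o⇒n≤o (varBound φ) le) a)

≐-sym : ∀ {Z} {X Y : Sub Z} → X ≐ Y → Y ≐ X
≐-sym (X⊆Y , Y⊆X) = Y⊆X , X⊆Y

≐-trans : ∀ {Z} {X Y W : Sub Z} → X ≐ Y → Y ≐ W → X ≐ W
≐-trans (X⊆Y , Y⊆X) (Y⊆W , W⊆Y) = (λ z → Y⊆W z ∘ X⊆Y z) , (λ z → Y⊆X z ∘ W⊆Y z)

module _ {Z : Set} (T : Z → Z → Set) where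

  Closed⁰ Closed¹ : Sub Z → Set
  Closed⁰ X = (T ⁽⁰⁾[ T ⁽¹⁾[ X ] ]) ⊆ X
  Closed¹ Y = (T ⁽¹⁾[ T ⁽⁰⁾[ Y ] ]) ⊆ Y

  ⁽⁰⁾-closed : ∀ Y → Closed⁰ (T ⁽⁰⁾[ Y ])
  ⁽⁰⁾-closed Y z h y y∈Y = h y (λ b b∈ → b∈ y y∈Y)

  ⁽¹⁾-closed : ∀ B → Closed¹ (T ⁽¹⁾[ B ])
  ⁽¹⁾-closed B y h b b∈B = h b (λ w w∈ → w∈ b b∈B)

  Closed⁰-resp-≐ : ∀ {X X'} → X ≐ X' → Closed⁰ X' → Closed⁰ X
  Closed⁰-resp-≐ (X⊆X' , X'⊆X) closed z h =
    X'⊆X z (closed z (λ w w∈ → h w (λ b b∈X → w∈ b (X⊆X' b b∈X))))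

  Closed¹-resp-≐ : ∀ {Y Y'} → Y ≐ Y' → Closed¹ Y' → Closed¹ Y
  Closed¹-resp-≐ (Y⊆Y' , Y'⊆Y) closed y h =
    Y'⊆Y y (closed y (λ b b∈ → h b (λ w w∈Y → b∈ w (Y⊆Y' w w∈Y))))

  ⁽¹⁾-resp-≐ : ∀ {X X'} → X ≐ X' → (T ⁽¹⁾[ X ]) ≐ (T ⁽¹⁾[ X' ])
  ⁽¹⁾-resp-≐ (X⊆X' , X'⊆X) = (λ y h b b∈ → h b (X'⊆X b b∈)) , (λ y h b b∈ → h b (X⊆X' b b∈))

infix 4 _∈↓_

_∈↓_ : Fm → List Fm → Set
c ∈↓ Φ = Any (c ⊢L_) Φ ⊎ c ⊢L ⊥'

_∈↓?_ : ∀ c Φ → Dec (c ∈↓ Φ)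
c ∈↓? Φ = any? (c ⊢L?_) Φ ⊎-dec (c ⊢L? ⊥')

∈↓-downward : ∀ {c d Φ} → c ⊢L d → d ∈↓ Φ → c ∈↓ Φ
∈↓-downward c⊢d (inj₁ d⊢Φ) = inj₁ (Any.map (cut c⊢d) d⊢Φ)
∈↓-downward c⊢d (inj₂ d⊢⊥) = inj₂ (cut c⊢d d⊢⊥)

∈↓-self : ∀ Φ → All (_∈↓ Φ) Φ
∈↓-self Φ = All.tabulate λ { φ∈Φ → inj₁ (Any.map (λ { refl → ⊢L-refl }) φ∈Φ) }

◇-∈↓ : ∀ {c y Φ} → All (λ φ → ◇ φ ⊢L y) Φ → c ∈↓ Φ → ◇ c ⊢L y
◇-∈↓ ◇Φ⊢y (inj₁ c⊢Φ) with All.lookupAny ◇Φ⊢y c⊢Φ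
... | ◇φ⊢y , c⊢φ = cut (◇-mono c⊢φ) ◇φ⊢y
◇-∈↓ ◇Φ⊢y (inj₂ c⊢⊥) = ◇-refutable c⊢⊥

freshVar : List Fm → Fm
freshVar Φ = var (sum (map varBound Φ))

fresh-var-∈↓ : ∀ Φ → freshVar Φ ∈↓ Φ → ⊤' ∈↓ Φ
fresh-var-∈↓ Φ (inj₁ m⊢Φ) = inj₁ (fresh-var-Any Φ ≤-refl m⊢Φ)
fresh-var-∈↓ Φ (inj₂ m⊢⊥) = ⊥-elim (var⊬⊥ m⊢⊥)

-- A point stands for the filter generated by fil and the ideal generated by
-- idl; dias lists formulas whose diamonds lie in that ideal.
record Point : Set where
  constructor point
  field
    fil        : Fm
    idl        : Fm
    dias       : List Fm
    consistent : ¬ (fil ⊢L idl)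
    ∈↓-trivial : fil ∈↓ dias → ⊤' ⊢L fil
    dias-below : All (λ φ → ◇ φ ⊢L idl) dias

open Point

fil⊬⊥ : ∀ z → ¬ (fil z ⊢L ⊥')
fil⊬⊥ z d = consistent z (cut d ⊥⊢L)

principal : ∀ {c y} → ¬ (c ⊢L y) → Point
principal {c} {y} c⊬y = point c y [] c⊬y trivial []
  where
  trivial : c ∈↓ [] → ⊤' ⊢L c
  trivial (inj₂ c⊢⊥) = ⊥-elim (c⊬y (cut c⊢⊥ ⊥⊢L))

⊤-point : ∀ {y Φ} → ¬ (⊤' ⊢L y) → All (λ φ → ◇ φ ⊢L y) Φ → Point
⊤-point {y} {Φ} ⊤⊬y ◇Φ⊢y = point ⊤' y Φ ⊤⊬y (λ _ → ⊢L-refl) ◇Φ⊢y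

-- The second component ties the diamonds of z to the filter of w; together
-- with ∈↓-trivial it keeps E reflexive while making the R◇-sets stable.
E : Point → Point → Set
E z w = ¬ (fil z ⊢L idl w) × ¬ (fil w ∈↓ dias z × ¬ (⊤' ⊢L fil w))

R□ : Point → Point → Set
R□ b w = ¬ (fil b ⊢L □ (idl w))

Covering : Fm → Sub Point
Covering c w = c ∈↓ dias w

CoveredBy : Point → Sub Point
CoveredBy w v = fil v ∈↓ dias w

R◇ : Point → Point → Set
R◇ w v = ¬ Covering (fil v) w

E-refl : ∀ z → E z z
E-refl z = consistent z , λ (z∈↓ , ⊤⊬z) → ⊤⊬z (∈↓-trivial z z∈↓)

infix 25 _¹ _⁰

_¹ _⁰ : Sub Point → Sub Point
B ¹ = E ⁽¹⁾[ B ]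
Y ⁰ = E ⁽⁰⁾[ Y ]

Up Down : Fm → Sub Point
Up c z   = fil z ⊢L c
Down c w = c ⊢L idl w

Up¹≐Down : ∀ c → Up c ¹ ≐ Down c
Up¹≐Down c = ⊆Down , λ w c⊢w z z⊢c (z⊬w , _) → z⊬w (cut z⊢c c⊢w)
  where
  ⊆Down : Up c ¹ ⊆ Down c
  ⊆Down w h = decidable-stable (c ⊢L? idl w) λ c⊬w →
    h (principal c⊬w) ⊢L-refl (c⊬w , λ { (inj₂ w⊢⊥ , _) → fil⊬⊥ w w⊢⊥ })

-- An anti-extension of χ need not be all of Down χ (for ◇-formulas it is not),
-- but it contains every point below χ whose dias cover finitely many witnesses.
record AntiExtension (χ : Fm) (Y : Sub Point) : Set where
  field
    below      : Y ⊆ Down χ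
    witnesses  : List Fm
    ◇witnesses : All (λ φ → ◇ φ ⊢L χ) witnesses
    complete   : ∀ w → χ ⊢L idl w → All (_∈↓ dias w) witnesses → Y w

  ⊤-point-∈ : (⊤⊬χ : ¬ (⊤' ⊢L χ)) → Y (⊤-point ⊤⊬χ ◇witnesses)
  ⊤-point-∈ _ = complete _ ⊢L-refl (∈↓-self witnesses)

open AntiExtension

AntiExtension-resp-≐ : ∀ {χ Y Y'} → Y ≐ Y' → AntiExtension χ Y' → AntiExtension χ Y
AntiExtension-resp-≐ (Y⊆Y' , Y'⊆Y) A = record
  { below      = λ w → below A w ∘ Y⊆Y' w
  ; witnesses  = witnesses A
  ; ◇witnesses = ◇witnesses A
  ; complete   = λ w χ⊢w cov → Y'⊆Y w (complete A w χ⊢w cov)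
  }

Down-anti : ∀ c → AntiExtension c (Down c)
Down-anti c = record
  { below = λ _ d → d ; witnesses = [] ; ◇witnesses = [] ; complete = λ _ d _ → d }

¹-anti : ∀ {χ X} → X ≐ Up χ → AntiExtension χ (X ¹)
¹-anti {χ} X≐Up =
  AntiExtension-resp-≐ (≐-trans (⁽¹⁾-resp-≐ E X≐Up) (Up¹≐Down χ)) (Down-anti χ)

anti⁰≐Up : ∀ {χ Y} → AntiExtension χ Y → Y ⁰ ≐ Up χ
anti⁰≐Up {χ} {Y} A = ⊆Up , λ z z⊢χ w w∈Y (z⊬w , _) → z⊬w (cut z⊢χ (below A w w∈Y))
  where
  ⊆Up : Y ⁰ ⊆ Up χ
  ⊆Up z h = decidable-stable (fil z ⊢L? χ) λ z⊬χ →
    let ⊤⊬χ : ¬ (⊤' ⊢L χ)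
        ⊤⊬χ ⊤⊢χ = z⊬χ (cut ⊢L⊤ ⊤⊢χ)
    in h _ (⊤-point-∈ A ⊤⊬χ) (z⊬χ , λ (_ , ⊤⊬⊤) → ⊤⊬⊤ ⊢L-refl)

anti-R□⁰≐Up□ : ∀ {χ Y} → AntiExtension χ Y → (R□ ⁽⁰⁾[ Y ]) ≐ Up (□ χ)
anti-R□⁰≐Up□ {χ} {Y} A =
  ⊆Up , λ b b⊢□χ w w∈Y b⊬□w → b⊬□w (cut b⊢□χ (□-mono (below A w w∈Y)))
  where
  ⊆Up : (R□ ⁽⁰⁾[ Y ]) ⊆ Up (□ χ)
  ⊆Up b h = decidable-stable (fil b ⊢L? □ χ) λ b⊬□χ →
    h _ (⊤-point-∈ A λ ⊤⊢χ → b⊬□χ (cut ⊢L□⊤ (□-mono ⊤⊢χ))) b⊬□χ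

Up-closed : ∀ c → Closed⁰ E (Up c)
Up-closed c = Closed⁰-resp-≐ E (≐-sym (anti⁰≐Up (Down-anti c))) (⁽⁰⁾-closed E (Down c))

Down-closed : ∀ c → Closed¹ E (Down c)
Down-closed c = Closed¹-resp-≐ E (≐-sym (Up¹≐Down c)) (⁽¹⁾-closed E (Up c))

Covering≐Up⁰ : ∀ {c} → ¬ (c ⊢L ⊥') → ¬ (⊤' ⊢L c) → Covering c ≐ Up c ⁰
Covering≐Up⁰ {c} c⊬⊥ ⊤⊬c =
  (λ z c∈z w w⊢c (_ , ¬cov) → ¬cov (∈↓-downward w⊢c c∈z , λ ⊤⊢w → ⊤⊬c (cut ⊤⊢w w⊢c))) ,
  (λ z h → decidable-stable (c ∈↓? dias z) λ c∉z →
     h (principal c⊬⊥) ⊢L-refl (fil⊬⊥ z , λ (c∈z , _) → c∉z c∈z))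

-- A formula c with ⊤ ⊢ c is separated from the dias of z by a variable
-- occurring in none of them.
Covering-closed-⊤ : ∀ {c} → ⊤' ⊢L c → Closed⁰ E (Covering c)
Covering-closed-⊤ {c} ⊤⊢c z h = decidable-stable (c ∈↓? dias z) λ c∉z →
  h (principal var⊬⊥) u∈
    (fil⊬⊥ z , λ (m∈z , _) → c∉z (∈↓-downward ⊢L⊤ (fresh-var-∈↓ (dias z) m∈z)))
  where
  u∈ : (Covering c ¹) (principal {freshVar (dias z)} var⊬⊥)
  u∈ w c∈w (_ , ¬cov) = ¬cov (∈↓-downward (cut ⊢L⊤ ⊤⊢c) c∈w , ⊤⊬var)

Covering-closed : ∀ {c} → ¬ (c ⊢L ⊥') → Closed⁰ E (Covering c)
Covering-closed {c} c⊬⊥ with ⊤' ⊢L? c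
... | yes ⊤⊢c = Covering-closed-⊤ ⊤⊢c
... | no ⊤⊬c  = Closed⁰-resp-≐ E (Covering≐Up⁰ c⊬⊥ ⊤⊬c) (⁽⁰⁾-closed E (Up c))

Covered-closed : ∀ w → Closed¹ E (CoveredBy w)
Covered-closed w u h = decidable-stable (fil u ∈↓? dias w) λ u∉w →
  h z (z∈ (u∉w ∘ ∈↓-downward ⊢L⊤))
    ((λ ⊤⊢u → consistent u (cut ⊢L⊤ ⊤⊢u)) , λ (u∈w , _) → u∉w u∈w)
  where
  z : Point
  z = ⊤-point (λ ⊤⊢w → consistent w (cut ⊢L⊤ ⊤⊢w)) (dias-below w)
  z∈ : ¬ (⊤' ∈↓ dias w) → (CoveredBy w ⁰) z
  z∈ ⊤∉w v v∈w (_ , ¬cov) = ¬cov (v∈w , λ ⊤⊢v → ⊤∉w (∈↓-downward ⊤⊢v v∈w))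

canonical : Frame
canonical = record
  { Z         = Point
  ; E         = E
  ; R◇        = R◇
  ; R□        = R□
  ; inhabited = ⊤-point ⊤⊬⊥ []
  ; E-refl    = E-refl
  ; □-stable₀ = λ y → Closed⁰-resp-≐ E (R□⁰-point y) (Up-closed (□ (idl y)))
  ; □-stable₁ = λ b → Closed¹-resp-≐ E (R□¹-point b) (Down-closed (□-content (fil b)))
  ; ◇-stable₀ = λ v → Closed⁰-resp-≐ E (R◇⁰-point v) (Covering-closed (fil⊬⊥ v))
  ; ◇-stable₁ = λ w → Closed¹-resp-≐ E (R◇¹-point w) (Covered-closed w)
  }
  where
  R□⁰-point : ∀ y → (R□ ⁽⁰⁾[ ｛ y ｝ ]) ≐ Up (□ (idl y))
  R□⁰-point y = (λ b h → decidable-stable (_ ⊢L? _) (h y refl))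
              , λ { b b⊢□y .y refl b⊬□y → b⊬□y b⊢□y }

  R□¹-point : ∀ b → (R□ ⁽¹⁾[ ｛ b ｝ ]) ≐ Down (□-content (fil b))
  R□¹-point b = (λ w h → to □-content-adjoint (decidable-stable (_ ⊢L? _) (h b refl)))
              , λ { w d .b refl b⊬□w → b⊬□w (from □-content-adjoint d) }

  R◇⁰-point : ∀ v → (R◇ ⁽⁰⁾[ ｛ v ｝ ]) ≐ Covering (fil v)
  R◇⁰-point v = (λ w h → decidable-stable (_ ∈↓? _) (h v refl))
              , λ { w v∈w .v refl v∉w → v∉w v∈w }

  R◇¹-point : ∀ w → (R◇ ⁽¹⁾[ ｛ w ｝ ]) ≐ CoveredBy w
  R◇¹-point w = (λ v h → decidable-stable (_ ∈↓? _) (h w refl))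
              , λ { v v∈w .w refl v∉w → v∉w v∈w }

valuation : Valuation canonical
valuation = record
  { ext  = Up ∘ var
  ; ant  = Down ∘ var
  ; ext¹ = Up¹≐Down ∘ var
  ; ant⁰ = anti⁰≐Up ∘ Down-anti ∘ var
  }

⟦_⟧ᶜ ⦅_⦆ᶜ : Fm → Sub Point
⟦_⟧ᶜ = ⟦_⟧ canonical valuation
⦅_⦆ᶜ = ⦅_⦆ canonical valuation

◇-anti : ∀ {φ X} → X ≐ Up φ → AntiExtension (◇ φ) (R◇ ⁽⁰⁾[ X ])
◇-anti {φ} {X} (X⊆Up , Up⊆X) = record
  { below      = below◇
  ; witnesses  = φ ∷ []
  ; ◇witnesses = ⊢L-refl ∷ []
  ; complete   = λ { w _ (φ∈w ∷ []) v v∈X v∉w → v∉w (∈↓-downward (X⊆Up v v∈X) φ∈w) }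
  }
  where
  below◇ : (R◇ ⁽⁰⁾[ X ]) ⊆ Down (◇ φ)
  below◇ w h with φ ⊢L? ⊥'
  ... | yes φ⊢⊥ = ◇-refutable φ⊢⊥
  ... | no φ⊬⊥  =
    ◇-∈↓ (dias-below w) (decidable-stable (_ ∈↓? _) (h (principal φ⊬⊥) (Up⊆X _ ⊢L-refl)))

∨-anti : ∀ {φ ψ Y Y'} → AntiExtension φ Y → AntiExtension ψ Y' →
         AntiExtension (φ ∨' ψ) (λ w → Y w × Y' w)
∨-anti A B = record
  { below      = λ { w (w∈Y , w∈Y') → ∨-elim (below A w w∈Y) (below B w w∈Y') }
  ; witnesses  = witnesses A ++ witnesses B
  ; ◇witnesses = ++⁺ (All.map (λ d → cut d ∨-inj₁) (◇witnesses A))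
                     (All.map (λ d → cut d ∨-inj₂) (◇witnesses B))
  ; complete   = λ w d cov → complete A w (cut ∨-inj₁ d) (++⁻ˡ (witnesses A) cov)
                           , complete B w (cut ∨-inj₂ d) (++⁻ʳ (witnesses A) cov)
  }

∧-≐Up : ∀ {φ ψ X X'} → X ≐ Up φ → X' ≐ Up ψ → (λ z → X z × X' z) ≐ Up (φ ∧' ψ)
∧-≐Up (X⊆ , ⊆X) (X'⊆ , ⊆X') =
  (λ { z (z∈X , z∈X') → ∧-intro (X⊆ z z∈X) (X'⊆ z z∈X') }) ,
  (λ z z⊢φ∧ψ → ⊆X z (cut z⊢φ∧ψ ∧-proj₁) , ⊆X' z (cut z⊢φ∧ψ ∧-proj₂))

truth : ∀ χ → (⟦ χ ⟧ᶜ ≐ Up χ) × AntiExtension χ ⦅ χ ⦆ᶜ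
truth ⊥' = ((λ _ ()) , λ z → ⊥-elim ∘ fil⊬⊥ z)
         , record { below = λ _ _ → ⊥⊢L ; witnesses = [] ; ◇witnesses = []
                  ; complete = λ _ _ _ → tt }
truth ⊤' = ((λ _ _ → ⊢L⊤) , λ _ _ → tt)
         , record { below = λ _ () ; witnesses = [] ; ◇witnesses = []
                  ; complete = λ w ⊤⊢w _ → ⊥-elim (consistent w (cut ⊢L⊤ ⊤⊢w)) }
truth (var n) = ((λ _ z∈ → z∈) , λ _ z∈ → z∈) , Down-anti (var n)
truth (φ ∧' ψ) = ext , ¹-anti ext
  where
  ext : ⟦ φ ∧' ψ ⟧ᶜ ≐ Up (φ ∧' ψ)
  ext = ∧-≐Up (proj₁ (truth φ)) (proj₁ (truth ψ))
truth (φ ∨' ψ) = anti⁰≐Up anti , anti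
  where
  anti : AntiExtension (φ ∨' ψ) ⦅ φ ∨' ψ ⦆ᶜ
  anti = ∨-anti (proj₂ (truth φ)) (proj₂ (truth ψ))
truth (□ φ) = ext , ¹-anti ext
  where
  ext : ⟦ □ φ ⟧ᶜ ≐ Up (□ φ)
  ext = anti-R□⁰≐Up□ (proj₂ (truth φ))
truth (◇ φ) = anti⁰≐Up anti , anti
  where
  anti : AntiExtension (◇ φ) ⦅ ◇ φ ⦆ᶜ
  anti = ◇-anti (proj₁ (truth φ))

theorem1 : (φ ψ : Fm) → ((F : Frame) → _⊨_⊢_ F φ ψ) → φ ⊢L ψ
theorem1 φ ψ valid = decidable-stable (φ ⊢L? ψ) λ φ⊬ψ →
  φ⊬ψ (proj₁ (anti⁰≐Up (proj₂ (truth ψ))) (principal φ⊬ψ)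
              (⟦φ⟧⊆⦅ψ⦆⁰ (principal φ⊬ψ) (proj₂ (proj₁ (truth φ)) _ ⊢L-refl)))
  where
  ⟦φ⟧⊆⦅ψ⦆⁰ : ⟦ φ ⟧ᶜ ⊆ ⦅ ψ ⦆ᶜ ⁰
  ⟦φ⟧⊆⦅ψ⦆⁰ z z∈⟦φ⟧ w w∈⦅ψ⦆ = valid canonical valuation z w z∈⟦φ⟧ w∈⦅ψ⦆
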